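{- For every integer $n\ge 1$, $$C_n(a,b;t)=C_{n-1}(a,b;t)+a^{n-1}t\sum_{k=1}^{n-1} b^{k}\, C_k(a,b;t)\, C_{n-k-1}\big(a,b;(ab)^k t\big).$$
   Context: A Dyck path of semilength $n$ is a word $P=s_1\ldots s_{2n}$ consisting of $n$ letters $0$ (up steps) and $n$ letters $1$ (down steps) such that every prefix contains at least as many $0$'s as $1$'s; let $\mathcal D_n$ be the set of these ($\mathcal D_0$ contains only the empty word). The descent set is $\mathrm{Des}\,P=\{i: s_i=1,\ s_{i+1}=0\}$ and $\mathrm{des}\,P=\#\mathrm{Des}\,P$. For $1\le i\le 2n$ let $|s_1\ldots s_i|_0$ and $|s_1\ldots s_i|_1$ denote the number of $0$'s and of $1$'s in the prefix $s_1\ldots s_i$. Put $\alpha(P)=\sum_{i\in\mathrm{Des}\,P}|s_1\ldots s_i|_0$ and $\beta(P)=\sum_{i\in\mathrm{Des}\,P}|s_1\ldots s_i|_1$. Define the polynomial $C_n(a,b;t)=\sum_{P\in\mathcal D_n}a^{\alpha(P)}b^{\beta(P)}t^{\mathrm{des}\,P}$; in particular $C_0(a,b;t)=1$. The notation $C_m(a,b;u)$ means this polynomial with $t$ replaced by $u$. -}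

module Defs where

open import Level using (Level)
open import Data.Bool using (T?; Bool; true; false; _∧_; if_then_else_)
open import Data.Nat using (ℕ; zero; suc; _+_; _∸_; _≡ᵇ_)
open import Data.List using (List; []; _∷_; map; filter; concatMap; foldr; length)
open import Data.Product using (_×_; _,_)
open import Algebra.Bundles using (CommutativeSemiring)

-- Letters: false = 0 (up step), true = 1 (down step).

words : ℕ → List (List Bool)
words zero    = [] ∷ []
words (suc m) = concatMap (λ w → (false ∷ w) ∷ (true ∷ w) ∷ []) (words m)

-- h = current (#0 − #1); Dyck iff never negative and ends at 0
dyckFrom : ℕ → List Bool → Bool
dyckFrom h          []            = h ≡ᵇ 0
dyckFrom h          (false ∷ w)   = dyckFrom (suc h) w
dyckFrom zero       (true ∷ w)    = false
dyckFrom (suc h)    (true ∷ w)    = dyckFrom h w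

isDyck : List Bool → Bool
isDyck = dyckFrom 0

dyckPaths : ℕ → List (List Bool)
dyckPaths n = filter (λ w → T? (isDyck w)) (words (n + n))

-- stats z o w: z, o = numbers of 0s and 1s in the prefix read so far;
-- returns (α, β, des) contributions of the remaining word w.
-- Position i is a descent iff s_i = 1 and s_{i+1} = 0; then it contributes
-- |s_1..s_i|_0 to α and |s_1..s_i|_1 to β.
stats : ℕ → ℕ → List Bool → ℕ × ℕ × ℕ
stats z o []                    = 0 , 0 , 0
stats z o (false ∷ w)           = stats (suc z) o w
stats z o (true ∷ [])           = 0 , 0 , 0
stats z o (true ∷ true ∷ w)     = stats z (suc o) (true ∷ w)
stats z o (true ∷ false ∷ w)    with stats z (suc o) (false ∷ w)
... | α , β , d = z + α , suc o + β , suc d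

alpha beta des : List Bool → ℕ
alpha w with stats 0 0 w
... | α , _ , _ = α
beta w with stats 0 0 w
... | _ , β , _ = β
des w with stats 0 0 w
... | _ , _ , d = d

-- [lo, lo+1, ..., hi] (empty if hi < lo)
range : ℕ → ℕ → List ℕ
range lo hi = go lo (suc hi ∸ lo)
  where
  go : ℕ → ℕ → List ℕ
  go s zero    = []
  go s (suc m) = s ∷ go (suc s) m

module _ {c ℓ : Level} (R : CommutativeSemiring c ℓ) where
  open CommutativeSemiring R using (Carrier; _*_; 1#; 0#) renaming (_+_ to _⊕_)

  pow : Carrier → ℕ → Carrier
  pow x zero    = 1#
  pow x (suc k) = x * pow x k

  sumR : List Carrier → Carrier
  sumR = foldr _⊕_ 0#

  C : ℕ → Carrier → Carrier → Carrier → Carrier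
  C n a b t = sumR (map (λ P → pow a (alpha P) * pow b (beta P) * pow t (des P)) (dyckPaths n))

  sumRange : ℕ → ℕ → (ℕ → Carrier) → Carrier
  sumRange lo hi f = sumR (map f (range lo hi))

module Submission where

-- The recurrence
--   C_{N+1}(t) = C_N(t) + a^N t Σ_{k=1}^{N} b^k C_k(t) C_{N-k}((ab)^k t)
-- is proved by a transfer-matrix argument on lattice walks.
--
-- A binary word is read as a walk in ℕ² from a diagonal point (s,s): a 0 moves right, a 1
-- moves up and is only allowed while the walk stays weakly below the diagonal, and reading
-- a 0 at (z,o) right after a 1 (a descent) costs a^z b^o t.
--
-- Section 2 shows that the
-- weights up_s(Z,O), down_s(Z,O) of the walks from (s,s) to (Z,O) ending with a 0,
-- respectively a 1, satisfy a one-step recursion in the end point (by peeling off the last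
-- letter).  Section 3 identifies Dyck paths with walks returning to the diagonal; since
-- starting at (s,s) multiplies every descent weight by (ab)^s, C_m((ab)^s t) is
-- up_s + down_s at (s+m,s+m).  Section 4 proves, by induction on the end point, the table
-- identity  b^o down_0(z,o) = Σ_{k=1}^{K} b^k C_k(t) up_k(z,o)  (o ≤ z ≤ K) with its
-- partial-sum companion; at (N,N) these give the recurrence, and theorem3p2 is its case n = N+1.

open import Defs
open import Level using (Level)
open import Data.Nat using (ℕ; _≤_; _∸_)
open import Algebra.Bundles using (CommutativeSemiring)
open import Data.Nat.Base using (zero; suc; _<_; _≡ᵇ_; _<ᵇ_; z≤n; s≤s; ⌊_/2⌋)
import Data.Nat.Properties as ℕₚ
open import Data.Bool using (Bool; true; false; T; if_then_else_; T?)
open import Data.Empty using (⊥; ⊥-elim)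
open import Data.Sum using (inj₁; inj₂)
open import Data.List using (List; []; _∷_; _++_; [_]; map; filter; concatMap; length)
open import Data.Product using (_×_; _,_)
open import Relation.Nullary using (¬_; yes; no)
open import Relation.Binary.PropositionalEquality as ≡ using (_≡_; _≢_)
import Relation.Binary.Reasoning.Setoid as SetoidReasoning
open import Data.Nat.Tactic.RingSolver using (solve-∀)
import Algebra.Properties.CommutativeSemigroup as CommSemigroupProps

module NatFacts where
  open import Data.Nat.Base using (_+_)

  ≡ᵇ-refl : ∀ n → (n ≡ᵇ n) ≡ true
  ≡ᵇ-refl zero    = ≡.refl
  ≡ᵇ-refl (suc n) = ≡ᵇ-refl n

  ≢⇒≡ᵇ-false : ∀ {m n} → m ≢ n → (m ≡ᵇ n) ≡ false
  ≢⇒≡ᵇ-false {m} {n} m≢n with m ≡ᵇ n in eq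
  ... | false = ≡.refl
  ... | true  = ⊥-elim (m≢n (ℕₚ.≡ᵇ⇒≡ m n (≡.subst T (≡.sym eq) _)))

  <⇒<ᵇ-true : ∀ {m n} → m < n → (m <ᵇ n) ≡ true
  <⇒<ᵇ-true {m} {n} m<n with m <ᵇ n in eq
  ... | true  = ≡.refl
  ... | false = ⊥-elim (≡.subst T eq (ℕₚ.<⇒<ᵇ m<n))

  ≮⇒<ᵇ-false : ∀ {m n} → ¬ m < n → (m <ᵇ n) ≡ false
  ≮⇒<ᵇ-false {m} {n} m≮n with m <ᵇ n in eq
  ... | false = ≡.refl
  ... | true  = ⊥-elim (m≮n (ℕₚ.<ᵇ⇒< m n (≡.subst T (≡.sym eq) _)))

  +-≡ᵇ-cancelʳ : ∀ h o → (h + o ≡ᵇ o) ≡ (h ≡ᵇ 0)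
  +-≡ᵇ-cancelʳ h zero    rewrite ℕₚ.+-identityʳ h = ≡.refl
  +-≡ᵇ-cancelʳ h (suc o) rewrite ℕₚ.+-suc h o     = +-≡ᵇ-cancelʳ h o

  diagonal-sum : ∀ {s Z O} → s ≡ Z → s ≡ O → Z + O ≡ s + s
  diagonal-sum ≡.refl ≡.refl = ≡.refl

  +-double-injective : ∀ x y → x + x ≡ y + y → x ≡ y
  +-double-injective x y eq =
    ≡.trans (ℕₚ.n≡⌊n+n/2⌋ x) (≡.trans (≡.cong ⌊_/2⌋ eq) (≡.sym (ℕₚ.n≡⌊n+n/2⌋ y)))

  off-diagonal : ∀ {z o n} → z + o ≡ n + n → z ≢ n → z ≢ o
  off-diagonal {z} {o} {n} eq z≢n z≡o = z≢n (+-double-injective z n (≡.trans (≡.cong (z +_) z≡o) eq))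

open NatFacts

module _ {c ℓ : Level} (R : CommutativeSemiring c ℓ) where
  open import Data.Nat.Base using (_+_; _*_)
  open CommutativeSemiring R renaming (_+_ to _⊕_; _*_ to _⊗_; zero to ⊗-zero)
  open SetoidReasoning setoid
  module +ₚ = CommSemigroupProps +-commutativeSemigroup
  module *ₚ = CommSemigroupProps *-commutativeSemigroup

  infixr 8 _^_
  _^_ : Carrier → ℕ → Carrier
  x ^ n = pow R x n

  -- Section 1.  Sums, powers and Iverson brackets

  sumL : {A : Set} → (A → Carrier) → List A → Carrier
  sumL f xs = sumR R (map f xs)

  sumL-cong : {A : Set} {f g : A → Carrier} (xs : List A) →
              (∀ x → f x ≈ g x) → sumL f xs ≈ sumL g xs
  sumL-cong []       f≈g = refl
  sumL-cong (x ∷ xs) f≈g = +-cong (f≈g x) (sumL-cong xs f≈g)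

  sumL-+ : {A : Set} (f g : A → Carrier) (xs : List A) →
           sumL (λ x → f x ⊕ g x) xs ≈ sumL f xs ⊕ sumL g xs
  sumL-+ f g []       = sym (+-identityˡ 0#)
  sumL-+ f g (x ∷ xs) = trans (+-congˡ (sumL-+ f g xs)) (+ₚ.interchange (f x) (g x) _ _)

  sumL-scale : {A : Set} (k : Carrier) (f : A → Carrier) (xs : List A) →
               sumL (λ x → k ⊗ f x) xs ≈ k ⊗ sumL f xs
  sumL-scale k f []       = sym (zeroʳ k)
  sumL-scale k f (x ∷ xs) = trans (+-congˡ (sumL-scale k f xs)) (sym (distribˡ k (f x) _))

  sumL-0 : {A : Set} (xs : List A) → sumL (λ _ → 0#) xs ≈ 0#
  sumL-0 []       = refl
  sumL-0 (x ∷ xs) = trans (+-identityˡ _) (sumL-0 xs)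

  sumBelow : ℕ → (ℕ → Carrier) → Carrier
  sumBelow zero    f = 0#
  sumBelow (suc n) f = sumBelow n f ⊕ f n

  sumBelow-cong : ∀ n {f g : ℕ → Carrier} → (∀ j → f j ≈ g j) → sumBelow n f ≈ sumBelow n g
  sumBelow-cong zero    f≈g = refl
  sumBelow-cong (suc n) f≈g = +-cong (sumBelow-cong n f≈g) (f≈g n)

  sumBelow-+ : ∀ n (f g : ℕ → Carrier) →
               sumBelow n (λ j → f j ⊕ g j) ≈ sumBelow n f ⊕ sumBelow n g
  sumBelow-+ zero    f g = sym (+-identityˡ 0#)
  sumBelow-+ (suc n) f g = trans (+-congʳ (sumBelow-+ n f g)) (+ₚ.interchange _ _ (f n) (g n))

  sumBelow-scale : ∀ n (k : Carrier) (f : ℕ → Carrier) →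
                   sumBelow n (λ j → k ⊗ f j) ≈ k ⊗ sumBelow n f
  sumBelow-scale zero    k f = sym (zeroʳ k)
  sumBelow-scale (suc n) k f = trans (+-congʳ (sumBelow-scale n k f)) (sym (distribˡ k _ (f n)))

  sumFrom : ℕ → ℕ → (ℕ → Carrier) → Carrier
  sumFrom lo zero    f = 0#
  sumFrom lo (suc m) f = f lo ⊕ sumFrom (suc lo) m f

  sumFrom-cong : ∀ m lo {f g : ℕ → Carrier} →
                 (∀ k → lo ≤ k → k < lo + m → f k ≈ g k) → sumFrom lo m f ≈ sumFrom lo m g
  sumFrom-cong zero    lo f≈g = refl
  sumFrom-cong (suc m) lo f≈g =
    +-cong (f≈g lo ℕₚ.≤-refl (≡.subst (lo <_) (≡.sym (ℕₚ.+-suc lo m)) (s≤s (ℕₚ.m≤m+n lo m))))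
           (sumFrom-cong m (suc lo) λ k lo<k k<lo+m →
              f≈g k (ℕₚ.<⇒≤ lo<k) (≡.subst (k <_) (≡.sym (ℕₚ.+-suc lo m)) k<lo+m))

  sumFrom-+ : ∀ m lo (f g : ℕ → Carrier) →
              sumFrom lo m (λ k → f k ⊕ g k) ≈ sumFrom lo m f ⊕ sumFrom lo m g
  sumFrom-+ zero    lo f g = sym (+-identityˡ 0#)
  sumFrom-+ (suc m) lo f g = trans (+-congˡ (sumFrom-+ m (suc lo) f g)) (+ₚ.interchange (f lo) (g lo) _ _)

  sumFrom-scale : ∀ m lo (k : Carrier) (f : ℕ → Carrier) →
                  sumFrom lo m (λ i → k ⊗ f i) ≈ k ⊗ sumFrom lo m f
  sumFrom-scale zero    lo k f = sym (zeroʳ k)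
  sumFrom-scale (suc m) lo k f = trans (+-congˡ (sumFrom-scale m (suc lo) k f)) (sym (distribˡ k (f lo) _))

  sumFrom-0 : ∀ m lo → sumFrom lo m (λ _ → 0#) ≈ 0#
  sumFrom-0 zero    lo = refl
  sumFrom-0 (suc m) lo = trans (+-identityˡ _) (sumFrom-0 m (suc lo))

  range-unfold : ∀ lo hi → lo ≤ hi → range lo hi ≡ lo ∷ range (suc lo) hi
  range-unfold lo hi lo≤hi rewrite ℕₚ.+-∸-assoc 1 lo≤hi = ≡.refl

  sumRange≈sumFrom : ∀ m lo hi (f : ℕ → Carrier) → suc hi ∸ lo ≡ m →
                     sumRange R lo hi f ≈ sumFrom lo m f
  sumRange≈sumFrom zero    lo hi f eq rewrite eq = refl
  sumRange≈sumFrom (suc m) lo hi f eq with lo ℕₚ.≤? hi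
  ... | yes lo≤hi rewrite range-unfold lo hi lo≤hi =
    +-congˡ (sumRange≈sumFrom m (suc lo) hi f
              (ℕₚ.suc-injective (≡.trans (≡.sym (ℕₚ.+-∸-assoc 1 lo≤hi)) eq)))
  ... | no lo≰hi with ≡.trans (≡.sym (ℕₚ.m≤n⇒m∸n≡0 (ℕₚ.≰⇒> lo≰hi))) eq
  ...   | ()

  pow-cong : ∀ {x y} n → x ≈ y → x ^ n ≈ y ^ n
  pow-cong zero    x≈y = refl
  pow-cong (suc n) x≈y = *-cong x≈y (pow-cong n x≈y)

  pow-+ : ∀ x m n → x ^ (m + n) ≈ x ^ m ⊗ x ^ n
  pow-+ x zero    n = sym (*-identityˡ _)
  pow-+ x (suc m) n = trans (*-congˡ (pow-+ x m n)) (sym (*-assoc x _ _))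

  pow-⊗ : ∀ x y n → (x ⊗ y) ^ n ≈ x ^ n ⊗ y ^ n
  pow-⊗ x y zero    = sym (*-identityˡ 1#)
  pow-⊗ x y (suc n) = trans (*-congˡ (pow-⊗ x y n)) (*ₚ.interchange x y _ _)

  pow-1# : ∀ n → 1# ^ n ≈ 1#
  pow-1# zero    = refl
  pow-1# (suc n) = trans (*-identityˡ _) (pow-1# n)

  pow-pow : ∀ x m n → (x ^ m) ^ n ≈ x ^ (m * n)
  pow-pow x zero    n = pow-1# n
  pow-pow x (suc m) n = begin
    (x ⊗ x ^ m) ^ n       ≈⟨ pow-⊗ x _ n ⟩
    x ^ n ⊗ (x ^ m) ^ n   ≈⟨ *-congˡ (pow-pow x m n) ⟩
    x ^ n ⊗ x ^ (m * n)   ≈⟨ sym (pow-+ x n (m * n)) ⟩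
    x ^ (n + m * n)       ∎

  keepIf : Bool → Carrier → Carrier
  keepIf c x = if c then x else 0#

  keepIf-cong : ∀ c {x y} → x ≈ y → keepIf c x ≈ keepIf c y
  keepIf-cong false x≈y = refl
  keepIf-cong true  x≈y = x≈y

  keepIf-scale : ∀ c y x → keepIf c (y ⊗ x) ≈ y ⊗ keepIf c x
  keepIf-scale false y x = sym (zeroʳ y)
  keepIf-scale true  y x = refl

  keepIf-0 : ∀ c → keepIf c 0# ≈ 0#
  keepIf-0 false = refl
  keepIf-0 true  = refl

  +-both-0 : ∀ {x y} → x ≈ 0# → y ≈ 0# → x ⊕ y ≈ 0#
  +-both-0 x≈0 y≈0 = trans (+-cong x≈0 y≈0) (+-identityˡ 0#)

  keepIf²-0 : ∀ c d → keepIf c (keepIf d 0#) ≈ 0#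
  keepIf²-0 c d = trans (keepIf-cong c (keepIf-0 d)) (keepIf-0 c)

  sumL-keepIf : {A : Set} (c : Bool) (f : A → Carrier) (xs : List A) →
                sumL (λ x → keepIf c (f x)) xs ≈ keepIf c (sumL f xs)
  sumL-keepIf false f xs = sumL-0 xs
  sumL-keepIf true  f xs = refl

  sumL-filter : ∀ (p : List Bool → Bool) (f : List Bool → Carrier) xs →
                sumL f (filter (λ w → T? (p w)) xs) ≈ sumL (λ w → keepIf (p w) (f w)) xs
  sumL-filter p f []       = refl
  sumL-filter p f (x ∷ xs) with p x
  ... | true  = +-congˡ (sumL-filter p f xs)
  ... | false = trans (sumL-filter p f xs) (sym (+-identityˡ _))

  sumWords : ℕ → (List Bool → Carrier) → Carrier
  sumWords m f = sumL f (words m)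

  sumWords-cons : ∀ m f → sumWords (suc m) f ≈ sumWords m (λ w → f (false ∷ w) ⊕ f (true ∷ w))
  sumWords-cons m f = go (words m)
    where
    go : ∀ ws → sumL f (concatMap (λ w → (false ∷ w) ∷ (true ∷ w) ∷ []) ws)
                ≈ sumL (λ w → f (false ∷ w) ⊕ f (true ∷ w)) ws
    go []       = refl
    go (w ∷ ws) = trans (+-congˡ (+-congˡ (go ws))) (sym (+-assoc _ _ _))

  sumWords-cong : ∀ m {f g : List Bool → Carrier} →
                  (∀ w → length w ≡ m → f w ≈ g w) → sumWords m f ≈ sumWords m g
  sumWords-cong zero    f≈g = +-congʳ (f≈g [] ≡.refl)
  sumWords-cong (suc m) {f} {g} f≈g = begin
    sumWords (suc m) f                               ≈⟨ sumWords-cons m f ⟩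
    sumWords m (λ w → f (false ∷ w) ⊕ f (true ∷ w))  ≈⟨ sumWords-cong m (λ w len →
                                                         +-cong (f≈g _ (≡.cong suc len)) (f≈g _ (≡.cong suc len))) ⟩
    sumWords m (λ w → g (false ∷ w) ⊕ g (true ∷ w))  ≈⟨ sym (sumWords-cons m g) ⟩
    sumWords (suc m) g                               ∎

  sumWords-snoc : ∀ m f → sumWords (suc m) f ≈ sumWords m (λ w → f (w ++ [ false ]) ⊕ f (w ++ [ true ]))
  sumWords-snoc zero    f = sym (+-assoc _ _ _)
  sumWords-snoc (suc m) f = begin
    sumWords (suc (suc m)) f                                 ≈⟨ sumWords-cons (suc m) f ⟩
    sumWords (suc m) h                                       ≈⟨ sumWords-snoc m h ⟩
    sumWords m (λ w → h (w ++ [ false ]) ⊕ h (w ++ [ true ])) ≈⟨ sumL-cong (words m) (λ w → +ₚ.interchange _ _ _ _) ⟩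
    sumWords m (λ w → f′ (false ∷ w) ⊕ f′ (true ∷ w))        ≈⟨ sym (sumWords-cons m f′) ⟩
    sumWords (suc m) f′                                      ∎
    where
    h f′ : List Bool → Carrier
    h  w = f (false ∷ w) ⊕ f (true ∷ w)
    f′ w = f (w ++ [ false ]) ⊕ f (w ++ [ true ])

  -- Section 2.  Weighted walks and their transfer tables

  module Walks (a b t : Carrier) where

    descent : ℕ → ℕ → Carrier
    descent z o = (a ^ z ⊗ b ^ o) ⊗ t

    descent-split : ∀ z o x → descent z o ⊗ x ≈ (a ^ z ⊗ t) ⊗ (b ^ o ⊗ x)
    descent-split z o x = begin
      ((a ^ z ⊗ b ^ o) ⊗ t) ⊗ x   ≈⟨ *-congʳ (*ₚ.xy∙z≈xz∙y (a ^ z) (b ^ o) t) ⟩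
      ((a ^ z ⊗ t) ⊗ b ^ o) ⊗ x   ≈⟨ *-assoc _ _ _ ⟩
      (a ^ z ⊗ t) ⊗ (b ^ o ⊗ x)   ∎

    -- A state (z , o , d) records the numbers of 0s and 1s read so far and whether the
    -- last letter was a 1.
    State : Set
    State = ℕ × ℕ × Bool

    move : State → Bool → State
    move (z , o , d) false = suc z , o , false
    move (z , o , d) true  = z , suc o , true

    endState : ℕ → ℕ → Bool → List Bool → State
    endState z o d []          = z , o , d
    endState z o d (false ∷ w) = endState (suc z) o false w
    endState z o d (true ∷ w)  = endState z (suc o) true w

    upFactor : Bool → ℕ → ℕ → Carrier
    upFactor false z o = 1#
    upFactor true  z o = descent z o

    -- The weight of the walk spelled by w from the state (z , o , d).  A 1 may only be read
    -- while o < z, i.e. the walk never crosses the diagonal; otherwise the weight is 0.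
    weight : ℕ → ℕ → Bool → List Bool → Carrier
    weight z o d []          = 1#
    weight z o d (false ∷ w) = upFactor d z o ⊗ weight (suc z) o false w
    weight z o d (true ∷ w)  = if o <ᵇ z then weight z (suc o) true w else 0#

    lastFactor : State → Bool → Carrier
    lastFactor (z , o , d) false = upFactor d z o
    lastFactor (z , o , d) true  = if o <ᵇ z then 1# else 0#

    endState-snoc : ∀ z o d w x → endState z o d (w ++ [ x ]) ≡ move (endState z o d w) x
    endState-snoc z o d []          false = ≡.refl
    endState-snoc z o d []          true  = ≡.refl
    endState-snoc z o d (false ∷ w) x     = endState-snoc (suc z) o false w x
    endState-snoc z o d (true ∷ w)  x     = endState-snoc z (suc o) true w x

    weight-snoc : ∀ z o d w x →
                  weight z o d (w ++ [ x ]) ≈ weight z o d w ⊗ lastFactor (endState z o d w) x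
    weight-snoc z o d []          false = trans (*-identityʳ _) (sym (*-identityˡ _))
    weight-snoc z o d []          true with o <ᵇ z
    ... | true  = sym (*-identityˡ 1#)
    ... | false = sym (zeroʳ 1#)
    weight-snoc z o d (false ∷ w) x =
      trans (*-congˡ (weight-snoc (suc z) o false w x)) (sym (*-assoc _ _ _))
    weight-snoc z o d (true ∷ w)  x with o <ᵇ z
    ... | true  = weight-snoc z (suc o) true w x
    ... | false = sym (zeroˡ _)

    sameKind : Bool → Bool → Bool
    sameKind false false = true
    sameKind true  true  = true
    sameKind false true  = false
    sameKind true  false = false

    atEnd : ℕ → ℕ → Bool → State → Carrier → Carrier
    atEnd Z O d (z , o , e) x = keepIf (z ≡ᵇ Z) (keepIf (o ≡ᵇ O) (keepIf (sameKind d e) x))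

    atEnd-cong : ∀ Z O d p {x y} → x ≈ y → atEnd Z O d p x ≈ atEnd Z O d p y
    atEnd-cong Z O d (z , o , e) x≈y =
      keepIf-cong (z ≡ᵇ Z) (keepIf-cong (o ≡ᵇ O) (keepIf-cong (sameKind d e) x≈y))

    walkEnd : ℕ → List Bool → State
    walkEnd s w = endState s s false w

    walkWeight : ℕ → List Bool → Carrier
    walkWeight s w = weight s s false w

    walks : ℕ → ℕ → ℕ → ℕ → Bool → Carrier
    walks s m Z O d = sumWords m (λ w → atEnd Z O d (walkEnd s w) (walkWeight s w))

    -- The same quantities by recursion on the end point.  atStart is the empty walk at (s,s);
    -- up and down collect the walks from (s,s) to (Z,O) whose last letter is 0 (or which
    -- are empty), resp. 1.
    atStart : ℕ → ℕ → ℕ → Carrier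
    atStart s Z O = keepIf (s ≡ᵇ Z) (keepIf (s ≡ᵇ O) 1#)

    up down : ℕ → ℕ → ℕ → Carrier
    up s zero    O = atStart s zero O
    up s (suc Z) O = atStart s (suc Z) O ⊕ (up s Z O ⊕ descent Z O ⊗ down s Z O)
    down s Z zero    = 0#
    down s Z (suc O) = keepIf (O <ᵇ Z) (up s Z O ⊕ down s Z O)

    table : ℕ → ℕ → ℕ → Bool → Carrier
    table s Z O false = up s Z O
    table s Z O true  = down s Z O

    atStart-off : ∀ s Z O → (s ≡ Z → s ≡ O → ⊥) → atStart s Z O ≈ 0#
    atStart-off s Z O s≢ with s ℕₚ.≟ Z
    ... | no s≢Z rewrite ≢⇒≡ᵇ-false s≢Z = refl
    ... | yes ≡.refl with s ℕₚ.≟ O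
    ...   | no s≢O rewrite ≡ᵇ-refl s | ≢⇒≡ᵇ-false s≢O = refl
    ...   | yes ≡.refl = ⊥-elim (s≢ ≡.refl ≡.refl)

    up-suc : ∀ s Z O → atStart s (suc Z) O ≈ 0# →
             up s (suc Z) O ≈ up s Z O ⊕ descent Z O ⊗ down s Z O
    up-suc s Z O off = trans (+-congʳ off) (+-identityˡ _)

    lastStep-0 : ∀ s Z O → up s Z O ≈ 0# → down s Z O ≈ 0# → up s Z O ⊕ descent Z O ⊗ down s Z O ≈ 0#
    lastStep-0 s Z O u≈0 d≈0 = +-both-0 u≈0 (trans (*-congˡ d≈0) (zeroʳ _))

    up-suc-0 : ∀ s Z O → atStart s (suc Z) O ≈ 0# → up s Z O ≈ 0# → down s Z O ≈ 0# →
               up s (suc Z) O ≈ 0#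
    up-suc-0 s Z O off u≈0 d≈0 = trans (up-suc s Z O off) (lastStep-0 s Z O u≈0 d≈0)

    down-suc-0 : ∀ s Z O → up s Z O ≈ 0# → down s Z O ≈ 0# → down s Z (suc O) ≈ 0#
    down-suc-0 s Z O u≈0 d≈0 = trans (keepIf-cong (O <ᵇ Z) (+-both-0 u≈0 d≈0)) (keepIf-0 _)

    table-above-diagonal : ∀ s Z O d → Z < O → table s Z O d ≈ 0#
    table-above-diagonal s zero    O false Z<O =
      atStart-off s 0 O (λ e₁ e₂ → ℕₚ.<-irrefl (≡.trans (≡.sym e₁) e₂) Z<O)
    table-above-diagonal s (suc Z) O false Z<O =
      up-suc-0 s Z O (atStart-off s (suc Z) O (λ e₁ e₂ → ℕₚ.<-irrefl (≡.trans (≡.sym e₁) e₂) Z<O))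
        (table-above-diagonal s Z O false Z<O′) (table-above-diagonal s Z O true Z<O′)
      where
      Z<O′ : Z < O
      Z<O′ = ℕₚ.<-trans (ℕₚ.n<1+n Z) Z<O
    table-above-diagonal s Z zero    true Z<O = refl
    table-above-diagonal s Z (suc O) true (s≤s Z≤O) rewrite ≮⇒<ᵇ-false {O} {Z} (ℕₚ.≤⇒≯ Z≤O) = refl

    table-before-start : ∀ s Z O d → Z + O < s + s → table s Z O d ≈ 0#
    table-before-start s zero    O false short =
      atStart-off s 0 O (λ e₁ e₂ → ℕₚ.<-irrefl (diagonal-sum e₁ e₂) short)
    table-before-start s (suc Z) O false short =
      up-suc-0 s Z O (atStart-off s (suc Z) O (λ e₁ e₂ → ℕₚ.<-irrefl (diagonal-sum e₁ e₂) short))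
        (table-before-start s Z O false short′) (table-before-start s Z O true short′)
      where
      short′ : Z + O < s + s
      short′ = ℕₚ.<-trans (ℕₚ.n<1+n (Z + O)) short
    table-before-start s Z zero    true short = refl
    table-before-start s Z (suc O) true short =
      down-suc-0 s Z O (table-before-start s Z O false short′) (table-before-start s Z O true short′)
      where
      short′ : Z + O < s + s
      short′ = ℕₚ.<-trans (ℕₚ.n<1+n (Z + O)) (≡.subst (_< s + s) (ℕₚ.+-suc Z O) short)

    empty-walk : ∀ s Z O d → Z + O ≡ s + s → atEnd Z O d (s , s , false) 1# ≈ table s Z O d
    empty-walk s zero    O false eq = refl
    empty-walk s (suc Z) O false eq =
      sym (trans (+-congˡ (lastStep-0 s Z O (table-before-start s Z O false short)
                                            (table-before-start s Z O true short)))
                 (+-identityʳ _))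
      where
      short : Z + O < s + s
      short = ≡.subst (Z + O <_) eq (ℕₚ.n<1+n (Z + O))
    empty-walk s Z zero    true eq = keepIf²-0 (s ≡ᵇ Z) (s ≡ᵇ 0)
    empty-walk s Z (suc O) true eq =
      trans (keepIf²-0 (s ≡ᵇ Z) (s ≡ᵇ suc O))
            (sym (down-suc-0 s Z O (table-before-start s Z O false short) (table-before-start s Z O true short)))
      where
      short : Z + O < s + s
      short = ≡.subst (Z + O <_) (≡.trans (≡.sym (ℕₚ.+-suc Z O)) eq) (ℕₚ.n<1+n (Z + O))

    extend : ℕ → ℕ → Bool → State → Carrier → Carrier
    extend Z O d p x = atEnd Z O d (move p false) (x ⊗ lastFactor p false)
                     ⊕ atEnd Z O d (move p true) (x ⊗ lastFactor p true)

    walks-snoc : ∀ s m Z O d →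
                 walks s (suc m) Z O d
                 ≈ sumWords m (λ w → extend Z O d (walkEnd s w) (walkWeight s w))
    walks-snoc s m Z O d =
      trans (sumWords-snoc m _) (sumL-cong (words m) λ w → +-cong (lastLetter w false) (lastLetter w true))
      where
      lastLetter : ∀ w x → atEnd Z O d (walkEnd s (w ++ [ x ])) (walkWeight s (w ++ [ x ]))
                           ≈ atEnd Z O d (move (walkEnd s w) x)
                                         (walkWeight s w ⊗ lastFactor (walkEnd s w) x)
      lastLetter w x rewrite endState-snoc s s false w x =
        atEnd-cong Z O d (move (walkEnd s w) x) (weight-snoc s s false w x)

    -- The one-step recursions of the tables, checked state by state: a walk ending in
    -- (Z+1 , O) by a 0 comes from (Z , O), paying a descent if it arrived there by a 1; a
    -- walk ending in (Z , O+1) by a 1 comes from (Z , O) and needs O < Z.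
    extend-up-0 : ∀ O p x → extend 0 O false p x ≈ 0#
    extend-up-0 O (z , o , e) x = trans (+-identityˡ _) (keepIf²-0 (z ≡ᵇ 0) (suc o ≡ᵇ O))

    extend-up : ∀ Z O p x →
                extend (suc Z) O false p x ≈ atEnd Z O false p x ⊕ descent Z O ⊗ atEnd Z O true p x
    extend-up Z O (z , o , e) x =
      trans (+-congˡ (keepIf²-0 (z ≡ᵇ suc Z) (suc o ≡ᵇ O))) (trans (+-identityʳ _) (byState e))
      where
      0≈0⊕d0 : 0# ≈ 0# ⊕ descent Z O ⊗ 0#
      0≈0⊕d0 = sym (trans (+-congˡ (zeroʳ _)) (+-identityʳ 0#))
      byState : ∀ e → keepIf (z ≡ᵇ Z) (keepIf (o ≡ᵇ O) (x ⊗ upFactor e z o))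
                      ≈ atEnd Z O false (z , o , e) x ⊕ descent Z O ⊗ atEnd Z O true (z , o , e) x
      byState e with z ℕₚ.≟ Z | o ℕₚ.≟ O
      ... | no z≢Z     | _ rewrite ≢⇒≡ᵇ-false z≢Z = 0≈0⊕d0
      ... | yes ≡.refl | no o≢O rewrite ≡ᵇ-refl z | ≢⇒≡ᵇ-false o≢O = 0≈0⊕d0
      ... | yes ≡.refl | yes ≡.refl rewrite ≡ᵇ-refl z | ≡ᵇ-refl o with e
      ...   | false = trans (*-identityʳ x) (sym (trans (+-congˡ (zeroʳ _)) (+-identityʳ x)))
      ...   | true  = trans (*-comm x _) (sym (+-identityˡ _))

    extend-down-0 : ∀ Z p x → extend Z 0 true p x ≈ 0#
    extend-down-0 Z (z , o , e) x =
      trans (+-cong (keepIf²-0 (suc z ≡ᵇ Z) (o ≡ᵇ 0)) (keepIf-0 (z ≡ᵇ Z))) (+-identityˡ 0#)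

    extend-down : ∀ Z O p x →
                  extend Z (suc O) true p x ≈ keepIf (O <ᵇ Z) (atEnd Z O false p x ⊕ atEnd Z O true p x)
    extend-down Z O (z , o , e) x =
      trans (+-congʳ (keepIf²-0 (suc z ≡ᵇ Z) (o ≡ᵇ suc O))) (trans (+-identityˡ _) (byState e))
      where
      0≈[]0⊕0 : 0# ≈ keepIf (O <ᵇ Z) (0# ⊕ 0#)
      0≈[]0⊕0 = sym (trans (keepIf-cong (O <ᵇ Z) (+-identityˡ 0#)) (keepIf-0 _))
      byState : ∀ e → keepIf (z ≡ᵇ Z) (keepIf (o ≡ᵇ O) (x ⊗ (if o <ᵇ z then 1# else 0#)))
                      ≈ keepIf (O <ᵇ Z) (atEnd Z O false (z , o , e) x ⊕ atEnd Z O true (z , o , e) x)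
      byState e with z ℕₚ.≟ Z | o ℕₚ.≟ O
      ... | no z≢Z     | _ rewrite ≢⇒≡ᵇ-false z≢Z = 0≈[]0⊕0
      ... | yes ≡.refl | no o≢O rewrite ≡ᵇ-refl z | ≢⇒≡ᵇ-false o≢O = 0≈[]0⊕0
      ... | yes ≡.refl | yes ≡.refl rewrite ≡ᵇ-refl z | ≡ᵇ-refl o with o <ᵇ z
      ...   | false = zeroʳ x
      ...   | true with e
      ...     | false = trans (*-identityʳ x) (sym (+-identityʳ x))
      ...     | true  = trans (*-identityʳ x) (sym (+-identityˡ x))

    walks-up-zero : ∀ s m O → walks s (suc m) 0 O false ≈ 0#
    walks-up-zero s m O = begin
      walks s (suc m) 0 O false  ≈⟨ walks-snoc s m 0 O false ⟩
      sumWords m (λ w → extend 0 O false (walkEnd s w) (walkWeight s w))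
                                 ≈⟨ sumL-cong (words m) (λ w → extend-up-0 O (walkEnd s w) (walkWeight s w)) ⟩
      sumWords m (λ _ → 0#)      ≈⟨ sumL-0 (words m) ⟩
      0#                         ∎

    walks-up-suc : ∀ s m Z O →
      walks s (suc m) (suc Z) O false ≈ walks s m Z O false ⊕ descent Z O ⊗ walks s m Z O true
    walks-up-suc s m Z O = begin
      walks s (suc m) (suc Z) O false
        ≈⟨ walks-snoc s m (suc Z) O false ⟩
      sumWords m (λ w → extend (suc Z) O false (walkEnd s w) (walkWeight s w))
        ≈⟨ sumL-cong (words m) (λ w → extend-up Z O (walkEnd s w) (walkWeight s w)) ⟩
      sumWords m (λ w → endsAt false w ⊕ descent Z O ⊗ endsAt true w)
        ≈⟨ sumL-+ _ _ (words m) ⟩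
      walks s m Z O false ⊕ sumWords m (λ w → descent Z O ⊗ endsAt true w)
        ≈⟨ +-congˡ (sumL-scale (descent Z O) _ (words m)) ⟩
      walks s m Z O false ⊕ descent Z O ⊗ walks s m Z O true ∎
      where
      endsAt : Bool → List Bool → Carrier
      endsAt d w = atEnd Z O d (walkEnd s w) (walkWeight s w)

    walks-down-zero : ∀ s m Z → walks s (suc m) Z 0 true ≈ 0#
    walks-down-zero s m Z = begin
      walks s (suc m) Z 0 true   ≈⟨ walks-snoc s m Z 0 true ⟩
      sumWords m (λ w → extend Z 0 true (walkEnd s w) (walkWeight s w))
                                 ≈⟨ sumL-cong (words m) (λ w → extend-down-0 Z (walkEnd s w) (walkWeight s w)) ⟩
      sumWords m (λ _ → 0#)      ≈⟨ sumL-0 (words m) ⟩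
      0#                         ∎

    walks-down-suc : ∀ s m Z O →
      walks s (suc m) Z (suc O) true ≈ keepIf (O <ᵇ Z) (walks s m Z O false ⊕ walks s m Z O true)
    walks-down-suc s m Z O = begin
      walks s (suc m) Z (suc O) true
        ≈⟨ walks-snoc s m Z (suc O) true ⟩
      sumWords m (λ w → extend Z (suc O) true (walkEnd s w) (walkWeight s w))
        ≈⟨ sumL-cong (words m) (λ w → extend-down Z O (walkEnd s w) (walkWeight s w)) ⟩
      sumWords m (λ w → keepIf (O <ᵇ Z) (endsAt false w ⊕ endsAt true w))
        ≈⟨ sumL-keepIf (O <ᵇ Z) _ (words m) ⟩
      keepIf (O <ᵇ Z) (sumWords m (λ w → endsAt false w ⊕ endsAt true w))
        ≈⟨ keepIf-cong (O <ᵇ Z) (sumL-+ _ _ (words m)) ⟩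
      keepIf (O <ᵇ Z) (walks s m Z O false ⊕ walks s m Z O true) ∎
      where
      endsAt : Bool → List Bool → Carrier
      endsAt d w = atEnd Z O d (walkEnd s w) (walkWeight s w)

    nonempty-off-start : ∀ s m Z O → Z + O ≡ s + s + suc m → atStart s Z O ≈ 0#
    nonempty-off-start s m Z O eq = atStart-off s Z O λ e₁ e₂ →
      ℕₚ.m≢1+m+n (s + s) (≡.trans (≡.sym (diagonal-sum e₁ e₂)) (≡.trans eq (ℕₚ.+-suc (s + s) m)))

    walks≈table : ∀ s m Z O d → Z + O ≡ s + s + m → walks s m Z O d ≈ table s Z O d
    walks≈table s zero    Z O d eq =
      trans (+-identityʳ _) (empty-walk s Z O d (≡.trans eq (ℕₚ.+-identityʳ (s + s))))
    walks≈table s (suc m) zero O false eq =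
      trans (walks-up-zero s m O) (sym (nonempty-off-start s m 0 O eq))
    walks≈table s (suc m) (suc Z) O false eq = begin
      walks s (suc m) (suc Z) O false                          ≈⟨ walks-up-suc s m Z O ⟩
      walks s m Z O false ⊕ descent Z O ⊗ walks s m Z O true   ≈⟨ +-cong (walks≈table s m Z O false eq′)
                                                                          (*-congˡ (walks≈table s m Z O true eq′)) ⟩
      up s Z O ⊕ descent Z O ⊗ down s Z O                      ≈⟨ sym (up-suc s Z O (nonempty-off-start s m (suc Z) O eq)) ⟩
      up s (suc Z) O                                           ∎
      where
      eq′ : Z + O ≡ s + s + m
      eq′ = ℕₚ.suc-injective (≡.trans eq (ℕₚ.+-suc (s + s) m))
    walks≈table s (suc m) Z zero    true eq = walks-down-zero s m Z
    walks≈table s (suc m) Z (suc O) true eq =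
      trans (walks-down-suc s m Z O)
            (keepIf-cong (O <ᵇ Z) (+-cong (walks≈table s m Z O false eq′) (walks≈table s m Z O true eq′)))
      where
      eq′ : Z + O ≡ s + s + m
      eq′ = ℕₚ.suc-injective (≡.trans (≡.trans (≡.sym (ℕₚ.+-suc Z O)) eq) (ℕₚ.+-suc (s + s) m))

    -- Section 3.  Dyck paths as walks from a diagonal point

    Stats : Set
    Stats = ℕ × ℕ × ℕ

    monomial : Stats → Carrier
    monomial (α , β , δ) = (a ^ α ⊗ b ^ β) ⊗ t ^ δ

    addDescent : ℕ → ℕ → Stats → Stats
    addDescent z o (α , β , δ) = z + α , o + β , suc δ

    monomial-addDescent : ∀ z o S → monomial (addDescent z o S) ≈ descent z o ⊗ monomial S
    monomial-addDescent z o (α , β , δ) = begin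
      (a ^ (z + α) ⊗ b ^ (o + β)) ⊗ (t ⊗ t ^ δ)                 ≈⟨ *-congʳ (*-cong (pow-+ a z α) (pow-+ b o β)) ⟩
      ((a ^ z ⊗ a ^ α) ⊗ (b ^ o ⊗ b ^ β)) ⊗ (t ⊗ t ^ δ)         ≈⟨ *-congʳ (*ₚ.interchange _ _ _ _) ⟩
      ((a ^ z ⊗ b ^ o) ⊗ (a ^ α ⊗ b ^ β)) ⊗ (t ⊗ t ^ δ)         ≈⟨ *ₚ.interchange _ _ _ _ ⟩
      ((a ^ z ⊗ b ^ o) ⊗ t) ⊗ ((a ^ α ⊗ b ^ β) ⊗ t ^ δ)         ∎

    -- The weight of the statistics of w read after z zeros and o ones when the previous
    -- letter was d: if that letter was a 1 and w starts with a 0, there is one more descent.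
    pending : Bool → ℕ → ℕ → List Bool → Carrier
    pending d z o []          = 1#
    pending d z o (false ∷ w) = upFactor d z o
    pending d z o (true ∷ w)  = 1#

    pending-false : ∀ z o w → pending false z o w ≡ 1#
    pending-false z o []          = ≡.refl
    pending-false z o (false ∷ w) = ≡.refl
    pending-false z o (true ∷ w)  = ≡.refl

    readWeight : Bool → ℕ → ℕ → List Bool → Carrier
    readWeight d z o w = pending d z o w ⊗ monomial (stats z o w)

    readWeight-down : ∀ z o w → monomial (stats z o (true ∷ w)) ≈ readWeight true z (suc o) w
    readWeight-down z o []          = sym (*-identityˡ _)
    readWeight-down z o (true ∷ w)  = sym (*-identityˡ _)
    readWeight-down z o (false ∷ w) = monomial-addDescent z (suc o) (stats z (suc o) (false ∷ w))

    balanced : State → Bool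
    balanced (z , o , _) = z ≡ᵇ o

    size : State → ℕ
    size (z , o , _) = z + o

    -- Reading w from height h = z - o, the statistics monomial restricted to Dyck suffixes is
    -- the automaton weight restricted to walks returning to the diagonal: a 1 read at height 0
    -- has weight 0, and ending at height 0 means ending balanced.
    automaton-reads-stats : ∀ w h o z → z ≡ h + o → ∀ d →
      keepIf (dyckFrom h w) (readWeight d z o w) ≈ keepIf (balanced (endState z o d w)) (weight z o d w)
    automaton-reads-stats [] h o z ≡.refl d rewrite +-≡ᵇ-cancelʳ h o =
      keepIf-cong (h ≡ᵇ 0) (trans (*-identityˡ _) (trans (*-identityʳ _) (*-identityʳ _)))
    automaton-reads-stats (false ∷ w) h o z eq d = begin
      keepIf D (upFactor d z o ⊗ M)                         ≈⟨ keepIf-scale D _ _ ⟩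
      upFactor d z o ⊗ keepIf D M                           ≈⟨ *-congˡ (keepIf-cong D M≈readWeight) ⟩
      upFactor d z o ⊗ keepIf D (readWeight false (suc z) o w)
        ≈⟨ *-congˡ (automaton-reads-stats w (suc h) o (suc z) (≡.cong suc eq) false) ⟩
      upFactor d z o ⊗ keepIf E (weight (suc z) o false w)  ≈⟨ sym (keepIf-scale E _ _) ⟩
      keepIf E (upFactor d z o ⊗ weight (suc z) o false w)  ∎
      where
      D E : Bool
      D = dyckFrom (suc h) w
      E = balanced (endState (suc z) o false w)
      M : Carrier
      M = monomial (stats (suc z) o w)
      M≈readWeight : M ≈ readWeight false (suc z) o w
      M≈readWeight = trans (sym (*-identityˡ M)) (*-congʳ (reflexive (≡.sym (pending-false (suc z) o w))))
    automaton-reads-stats (true ∷ w) zero o z ≡.refl d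
      rewrite ≮⇒<ᵇ-false {o} {o} (ℕₚ.<-irrefl ≡.refl) = sym (keepIf-0 _)
    automaton-reads-stats (true ∷ w) (suc h) o z ≡.refl d
      rewrite <⇒<ᵇ-true {o} {suc (h + o)} (s≤s (ℕₚ.m≤n+m o h)) =
      trans (keepIf-cong (dyckFrom h w) (trans (*-identityˡ _) (readWeight-down _ o w)))
            (automaton-reads-stats w h (suc o) (suc (h + o)) (≡.sym (ℕₚ.+-suc h o)) true)

    -- Starting k steps further along the diagonal raises α and β by k for every descent.
    shiftStats : ℕ → Stats → Stats
    shiftStats k (α , β , δ) = α + k * δ , β + k * δ , δ

    addDescent-shift : ∀ z o k S →
                       addDescent (z + k) (o + k) (shiftStats k S) ≡ shiftStats k (addDescent z o S)
    addDescent-shift z o k (α , β , δ) = ≡.cong₂ _,_ (arith z k α δ) (≡.cong₂ _,_ (arith o k β δ) ≡.refl)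
      where
      arith : ∀ x k γ δ → (x + k) + (γ + k * δ) ≡ x + γ + k * suc δ
      arith = solve-∀

    stats-shift : ∀ z o k w → stats (z + k) (o + k) w ≡ shiftStats k (stats z o w)
    stats-shift z o k []                 rewrite ℕₚ.*-zeroʳ k = ≡.refl
    stats-shift z o k (false ∷ w)        = stats-shift (suc z) o k w
    stats-shift z o k (true ∷ [])        rewrite ℕₚ.*-zeroʳ k = ≡.refl
    stats-shift z o k (true ∷ true ∷ w)  = stats-shift z (suc o) k (true ∷ w)
    stats-shift z o k (true ∷ false ∷ w) =
      ≡.trans (≡.cong (addDescent (z + k) (suc (o + k))) (stats-shift z (suc o) k (false ∷ w)))
              (addDescent-shift z (suc o) k (stats z (suc o) (false ∷ w)))

    -- Replacing t by (ab)^k t has the same effect on the monomial.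
    monomial-shift : ∀ k α β δ →
                     (a ^ α ⊗ b ^ β) ⊗ ((a ⊗ b) ^ k ⊗ t) ^ δ ≈ monomial (shiftStats k (α , β , δ))
    monomial-shift k α β δ = begin
      (A ⊗ B) ⊗ ((a ⊗ b) ^ k ⊗ t) ^ δ                    ≈⟨ *-congˡ (pow-⊗ _ t δ) ⟩
      (A ⊗ B) ⊗ (((a ⊗ b) ^ k) ^ δ ⊗ t ^ δ)
        ≈⟨ *-congˡ (*-congʳ (trans (pow-pow (a ⊗ b) k δ) (pow-⊗ a b (k * δ)))) ⟩
      (A ⊗ B) ⊗ ((a ^ (k * δ) ⊗ b ^ (k * δ)) ⊗ t ^ δ)    ≈⟨ sym (*-assoc _ _ _) ⟩
      ((A ⊗ B) ⊗ (a ^ (k * δ) ⊗ b ^ (k * δ))) ⊗ t ^ δ    ≈⟨ *-congʳ (*ₚ.interchange _ _ _ _) ⟩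
      ((A ⊗ a ^ (k * δ)) ⊗ (B ⊗ b ^ (k * δ))) ⊗ t ^ δ
        ≈⟨ *-congʳ (sym (*-cong (pow-+ a α (k * δ)) (pow-+ b β (k * δ)))) ⟩
      (a ^ (α + k * δ) ⊗ b ^ (β + k * δ)) ⊗ t ^ δ        ∎
      where
      A B : Carrier
      A = a ^ α
      B = b ^ β

    endState-size : ∀ z o d w → size (endState z o d w) ≡ z + o + length w
    endState-size z o d []          = ≡.sym (ℕₚ.+-identityʳ _)
    endState-size z o d (false ∷ w) =
      ≡.trans (endState-size (suc z) o false w) (≡.sym (ℕₚ.+-suc (z + o) (length w)))
    endState-size z o d (true ∷ w)  =
      ≡.trans (endState-size z (suc o) true w)
              (≡.trans (≡.cong (_+ length w) (ℕₚ.+-suc z o)) (≡.sym (ℕₚ.+-suc (z + o) (length w))))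

    balanced-split : ∀ n p x → size p ≡ n + n →
                     keepIf (balanced p) x ≈ atEnd n n false p x ⊕ atEnd n n true p x
    balanced-split n (z , o , e) x eq with z ℕₚ.≟ n
    ... | no z≢n rewrite ≢⇒≡ᵇ-false z≢n | ≢⇒≡ᵇ-false (off-diagonal {z} {o} {n} eq z≢n) =
      sym (+-identityˡ 0#)
    ... | yes ≡.refl with ℕₚ.+-cancelˡ-≡ z o z eq
    ...   | ≡.refl rewrite ≡ᵇ-refl z with e
    ...     | false = sym (+-identityʳ x)
    ...     | true  = sym (+-identityˡ x)

    shiftedC≈tables : ∀ s m → C R m a b ((a ⊗ b) ^ s ⊗ t) ≈ up s (s + m) (s + m) ⊕ down s (s + m) (s + m)
    shiftedC≈tables s m = begin
      C R m a b t′                                               ≈⟨ sumL-filter isDyck term (words (m + m)) ⟩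
      sumWords (m + m) (λ w → keepIf (isDyck w) (term w))        ≈⟨ sumWords-cong (m + m) perWord ⟩
      sumWords (m + m) atTop                                     ≈⟨ sumL-+ _ _ (words (m + m)) ⟩
      walks s (m + m) top top false ⊕ walks s (m + m) top top true
        ≈⟨ +-cong (walks≈table s (m + m) top top false length-eq) (walks≈table s (m + m) top top true length-eq) ⟩
      up s top top ⊕ down s top top                              ∎
      where
      t′ : Carrier
      t′ = (a ⊗ b) ^ s ⊗ t
      top : ℕ
      top = s + m
      term : List Bool → Carrier
      term P = a ^ alpha P ⊗ b ^ beta P ⊗ t′ ^ des P
      atTop : List Bool → Carrier
      atTop w = atEnd top top false (walkEnd s w) (walkWeight s w) ⊕ atEnd top top true (walkEnd s w) (walkWeight s w)
      length-eq : top + top ≡ s + s + (m + m)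
      length-eq = arith s m
        where
        arith : ∀ x y → x + y + (x + y) ≡ x + x + (y + y)
        arith = solve-∀
      term≈readWeight : ∀ w → term w ≈ readWeight false s s w
      term≈readWeight w = begin
        term w                                  ≈⟨ monomial-shift s (alpha w) (beta w) (des w) ⟩
        monomial (shiftStats s (stats 0 0 w))   ≡⟨ ≡.cong monomial (≡.sym (stats-shift 0 0 s w)) ⟩
        monomial (stats s s w)                  ≈⟨ sym (*-identityˡ _) ⟩
        1# ⊗ monomial (stats s s w)             ≡⟨ ≡.cong (_⊗ monomial (stats s s w)) (≡.sym (pending-false s s w)) ⟩
        readWeight false s s w                  ∎
      perWord : ∀ w → length w ≡ m + m → keepIf (isDyck w) (term w) ≈ atTop w
      perWord w len = begin
        keepIf (isDyck w) (term w)                        ≈⟨ keepIf-cong (isDyck w) (term≈readWeight w) ⟩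
        keepIf (isDyck w) (readWeight false s s w)        ≈⟨ automaton-reads-stats w 0 s s ≡.refl false ⟩
        keepIf (balanced (walkEnd s w)) (walkWeight s w)  ≈⟨ balanced-split top (walkEnd s w) (walkWeight s w) size-eq ⟩
        atTop w                                           ∎
        where
        size-eq : size (walkEnd s w) ≡ top + top
        size-eq = ≡.trans (endState-size s s false w) (≡.trans (≡.cong (s + s +_) len) (≡.sym length-eq))

    -- Section 4.  The recurrence

    down-as-sum : ∀ s Z O → O ≤ Z → down s Z O ≈ sumBelow O (up s Z)
    down-as-sum s Z zero    O≤Z = refl
    down-as-sum s Z (suc O) O<Z rewrite <⇒<ᵇ-true O<Z =
      trans (+-comm _ _) (+-congʳ (down-as-sum s Z O (ℕₚ.<⇒≤ O<Z)))

    down-suc : ∀ s Z O → O < Z → down s Z (suc O) ≈ up s Z O ⊕ down s Z O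
    down-suc s Z O O<Z rewrite <⇒<ᵇ-true O<Z = refl

    -- Only the empty walk ends on the diagonal with a 0.
    up-diagonal : ∀ s Z → up s (suc Z) (suc Z) ≈ atStart s (suc Z) (suc Z)
    up-diagonal s Z =
      trans (+-congˡ (lastStep-0 s Z (suc Z) (table-above-diagonal s Z (suc Z) false (ℕₚ.n<1+n Z))
                                             (table-above-diagonal s Z (suc Z) true (ℕₚ.n<1+n Z))))
            (+-identityʳ _)

    diag : ℕ → Carrier
    diag m = up 0 m m ⊕ down 0 m m

    C-cong : ∀ m {u v} → u ≈ v → C R m a b u ≈ C R m a b v
    C-cong m u≈v = sumL-cong (dyckPaths m) (λ P → *-congˡ (pow-cong (des P) u≈v))

    C≈diag : ∀ m → C R m a b t ≈ diag m
    C≈diag m = trans (C-cong m (sym (*-identityˡ t))) (shiftedC≈tables 0 m)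

    diag-suc : ∀ m → diag (suc m) ≈ down 0 (suc m) (suc m)
    diag-suc m = trans (+-congʳ (up-diagonal 0 m)) (+-identityˡ _)

    down₀-next-column : ∀ z o → o ≤ suc z →
      down 0 (suc z) o ≈ sumBelow o (up 0 z) ⊕ (a ^ z ⊗ t) ⊗ sumBelow o (λ j → b ^ j ⊗ down 0 z j)
    down₀-next-column z o o≤1+z = begin
      down 0 (suc z) o                                                   ≈⟨ down-as-sum 0 (suc z) o o≤1+z ⟩
      sumBelow o (up 0 (suc z))                                          ≈⟨ sumBelow-cong o (λ j → up-suc 0 z j refl) ⟩
      sumBelow o (λ j → up 0 z j ⊕ descent z j ⊗ down 0 z j)             ≈⟨ sumBelow-+ o _ _ ⟩
      sumBelow o (up 0 z) ⊕ sumBelow o (λ j → descent z j ⊗ down 0 z j)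
                                                                         ≈⟨ +-congˡ (sumBelow-cong o (λ j → descent-split z j _)) ⟩
      sumBelow o (up 0 z) ⊕ sumBelow o (λ j → (a ^ z ⊗ t) ⊗ (b ^ j ⊗ down 0 z j))
                                                                         ≈⟨ +-congˡ (sumBelow-scale o _ _) ⟩
      sumBelow o (up 0 z) ⊕ (a ^ z ⊗ t) ⊗ sumBelow o (λ j → b ^ j ⊗ down 0 z j) ∎

    diagWeight : ℕ → Carrier
    diagWeight k = b ^ k ⊗ diag k

    fromDiagonal : ℕ → ℕ → ℕ → Bool → Carrier
    fromDiagonal K z o d = sumFrom 1 K (λ k → diagWeight k ⊗ table k z o d)

    fromDiagonal-up-suc : ∀ K z o → o ≤ z →
      fromDiagonal K (suc z) o false ≈ fromDiagonal K z o false ⊕ descent z o ⊗ fromDiagonal K z o true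
    fromDiagonal-up-suc K z o o≤z = sym (begin
      fromDiagonal K z o false ⊕ descent z o ⊗ fromDiagonal K z o true
        ≈⟨ +-congˡ (sym (sumFrom-scale K 1 (descent z o) _)) ⟩
      fromDiagonal K z o false ⊕ sumFrom 1 K (λ k → descent z o ⊗ (diagWeight k ⊗ down k z o))
        ≈⟨ sym (sumFrom-+ K 1 _ _) ⟩
      sumFrom 1 K (λ k → diagWeight k ⊗ up k z o ⊕ descent z o ⊗ (diagWeight k ⊗ down k z o))
        ≈⟨ sumFrom-cong K 1 (λ k _ _ → lastStep k) ⟩
      fromDiagonal K (suc z) o false ∎)
      where
      notStart : ∀ {k} → k ≡ suc z → k ≡ o → ⊥
      notStart e₁ e₂ = ℕₚ.<-irrefl (≡.trans (≡.sym e₂) e₁) (s≤s o≤z)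
      lastStep : ∀ k → diagWeight k ⊗ up k z o ⊕ descent z o ⊗ (diagWeight k ⊗ down k z o)
                       ≈ diagWeight k ⊗ up k (suc z) o
      lastStep k = sym (begin
        diagWeight k ⊗ up k (suc z) o
          ≈⟨ *-congˡ (up-suc k z o (atStart-off k (suc z) o notStart)) ⟩
        diagWeight k ⊗ (up k z o ⊕ descent z o ⊗ down k z o)
          ≈⟨ distribˡ _ _ _ ⟩
        diagWeight k ⊗ up k z o ⊕ diagWeight k ⊗ (descent z o ⊗ down k z o)
          ≈⟨ +-congˡ (*ₚ.x∙yz≈y∙xz _ _ _) ⟩
        diagWeight k ⊗ up k z o ⊕ descent z o ⊗ (diagWeight k ⊗ down k z o) ∎)

    fromDiagonal-down-suc : ∀ K z o → o < z →
      fromDiagonal K z (suc o) true ≈ fromDiagonal K z o false ⊕ fromDiagonal K z o true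
    fromDiagonal-down-suc K z o o<z =
      trans (sumFrom-cong K 1 (λ k _ _ → trans (*-congˡ (down-suc k z o o<z)) (distribˡ _ _ _)))
            (sumFrom-+ K 1 _ _)

    sumFrom-atStart-none : ∀ m lo Z (g : ℕ → Carrier) → Z < lo →
                           sumFrom lo m (λ k → g k ⊗ atStart k Z Z) ≈ 0#
    sumFrom-atStart-none zero    lo Z g Z<lo = refl
    sumFrom-atStart-none (suc m) lo Z g Z<lo =
      +-both-0 (trans (*-congˡ (atStart-off lo Z Z (λ e _ → ℕₚ.<-irrefl (≡.sym e) Z<lo))) (zeroʳ _))
               (sumFrom-atStart-none m (suc lo) Z g (ℕₚ.<-trans Z<lo (ℕₚ.n<1+n lo)))

    sumFrom-atStart : ∀ m lo Z (g : ℕ → Carrier) → lo ≤ Z → Z < lo + m →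
                      sumFrom lo m (λ k → g k ⊗ atStart k Z Z) ≈ g Z
    sumFrom-atStart zero    lo Z g lo≤Z Z<lo+0 =
      ⊥-elim (ℕₚ.<-irrefl ≡.refl (ℕₚ.<-≤-trans Z<lo+0 (≡.subst (_≤ Z) (≡.sym (ℕₚ.+-identityʳ lo)) lo≤Z)))
    sumFrom-atStart (suc m) lo Z g lo≤Z Z<lo+m with lo ℕₚ.≟ Z
    ... | yes ≡.refl rewrite ≡ᵇ-refl lo =
      trans (+-congˡ (sumFrom-atStart-none m (suc lo) lo g (ℕₚ.n<1+n lo)))
            (trans (+-identityʳ _) (*-identityʳ _))
    ... | no lo≢Z =
      trans (+-congʳ (trans (*-congˡ (atStart-off lo Z Z (λ e _ → lo≢Z e))) (zeroʳ _)))
            (trans (+-identityˡ _)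
                   (sumFrom-atStart m (suc lo) Z g (ℕₚ.≤∧≢⇒< lo≤Z lo≢Z) (≡.subst (Z <_) (ℕₚ.+-suc lo m) Z<lo+m)))

    fromDiagonal-diagonal : ∀ K z → suc z ≤ K → fromDiagonal K (suc z) (suc z) false ≈ diagWeight (suc z)
    fromDiagonal-diagonal K z 1+z≤K =
      trans (sumFrom-cong K 1 (λ k _ _ → *-congˡ (up-diagonal k z)))
            (sumFrom-atStart K 1 (suc z) diagWeight (s≤s z≤n) (s≤s 1+z≤K))

    weighted-down : ∀ K z o → z ≤ K → o ≤ z → b ^ o ⊗ down 0 z o ≈ fromDiagonal K z o false
    weighted-down-sum : ∀ K z o → z ≤ K → o ≤ z →
                        sumBelow o (λ j → b ^ j ⊗ down 0 z j) ≈ fromDiagonal K z o true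

    weighted-down K zero    zero z≤K o≤z =
      trans (zeroʳ _) (sym (sumFrom-atStart-none K 1 0 diagWeight (s≤s z≤n)))
    weighted-down K (suc z) o 1+z≤K o≤1+z with ℕₚ.m≤n⇒m<n∨m≡n o≤1+z
    ... | inj₂ ≡.refl = begin
      b ^ suc z ⊗ down 0 (suc z) (suc z)  ≈⟨ *-congˡ (sym (diag-suc z)) ⟩
      diagWeight (suc z)                  ≈⟨ sym (fromDiagonal-diagonal K z 1+z≤K) ⟩
      fromDiagonal K (suc z) (suc z) false ∎
    ... | inj₁ (s≤s o≤z) = begin
      b ^ o ⊗ down 0 (suc z) o
        ≈⟨ *-congˡ (down₀-next-column z o o≤1+z) ⟩
      b ^ o ⊗ (sumBelow o (up 0 z) ⊕ (a ^ z ⊗ t) ⊗ Σdown)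
        ≈⟨ *-congˡ (+-congʳ (sym (down-as-sum 0 z o o≤z))) ⟩
      b ^ o ⊗ (down 0 z o ⊕ (a ^ z ⊗ t) ⊗ Σdown)
        ≈⟨ distribˡ _ _ _ ⟩
      b ^ o ⊗ down 0 z o ⊕ b ^ o ⊗ ((a ^ z ⊗ t) ⊗ Σdown)
        ≈⟨ +-congˡ (trans (*ₚ.x∙yz≈y∙xz _ _ _) (sym (descent-split z o Σdown))) ⟩
      b ^ o ⊗ down 0 z o ⊕ descent z o ⊗ Σdown
        ≈⟨ +-cong (weighted-down K z o z≤K o≤z) (*-congˡ (weighted-down-sum K z o z≤K o≤z)) ⟩
      fromDiagonal K z o false ⊕ descent z o ⊗ fromDiagonal K z o true
        ≈⟨ sym (fromDiagonal-up-suc K z o o≤z) ⟩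
      fromDiagonal K (suc z) o false ∎
      where
      z≤K : z ≤ K
      z≤K = ℕₚ.≤-trans (ℕₚ.n≤1+n z) 1+z≤K
      Σdown : Carrier
      Σdown = sumBelow o (λ j → b ^ j ⊗ down 0 z j)

    weighted-down-sum K z zero    z≤K o≤z =
      sym (trans (sumFrom-cong K 1 (λ k _ _ → zeroʳ (diagWeight k))) (sumFrom-0 K 1))
    weighted-down-sum K z (suc o) z≤K o<z = begin
      sumBelow o (λ j → b ^ j ⊗ down 0 z j) ⊕ b ^ o ⊗ down 0 z o
        ≈⟨ +-cong (weighted-down-sum K z o z≤K o≤z) (weighted-down K z o z≤K o≤z) ⟩
      fromDiagonal K z o true ⊕ fromDiagonal K z o false ≈⟨ +-comm _ _ ⟩
      fromDiagonal K z o false ⊕ fromDiagonal K z o true ≈⟨ sym (fromDiagonal-down-suc K z o o<z) ⟩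
      fromDiagonal K z (suc o) true ∎
      where
      o≤z : o ≤ z
      o≤z = ℕₚ.<⇒≤ o<z

    returns : ∀ N → sumBelow (suc N) (λ j → b ^ j ⊗ down 0 N j)
                    ≈ sumFrom 1 N (λ k → diagWeight k ⊗ (up k N N ⊕ down k N N))
    returns N = begin
      sumBelow N (λ j → b ^ j ⊗ down 0 N j) ⊕ b ^ N ⊗ down 0 N N
        ≈⟨ +-cong (weighted-down-sum N N N ℕₚ.≤-refl ℕₚ.≤-refl)
                  (weighted-down N N N ℕₚ.≤-refl ℕₚ.≤-refl) ⟩
      fromDiagonal N N N true ⊕ fromDiagonal N N N false   ≈⟨ +-comm _ _ ⟩
      fromDiagonal N N N false ⊕ fromDiagonal N N N true   ≈⟨ sym (sumFrom-+ N 1 _ _) ⟩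
      sumFrom 1 N (λ k → diagWeight k ⊗ up k N N ⊕ diagWeight k ⊗ down k N N)
        ≈⟨ sumFrom-cong N 1 (λ k _ _ → sym (distribˡ _ _ _)) ⟩
      sumFrom 1 N (λ k → diagWeight k ⊗ (up k N N ⊕ down k N N)) ∎

    term-k : ∀ N k → 1 ≤ k → k < 1 + N →
             diagWeight k ⊗ (up k N N ⊕ down k N N)
             ≈ b ^ k ⊗ C R k a b t ⊗ C R (suc N ∸ k ∸ 1) a b ((a ⊗ b) ^ k ⊗ t)
    term-k N k 1≤k (s≤s k≤N) rewrite ℕₚ.∸-+-assoc (suc N) k 1 | ℕₚ.+-comm k 1 =
      *-cong (*-congˡ (sym (C≈diag k)))
             (sym (trans (shiftedC≈tables k (N ∸ k))
                         (reflexive (≡.cong (λ M → up k M M ⊕ down k M M) (ℕₚ.m+[n∸m]≡n k≤N)))))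

    -- The recurrence for n = N + 1: the last column of walks from the origin to (N+1,N+1)
    -- splits into C_N(t) and the walks making a final descent from column N.
    recurrence : ∀ N → C R (suc N) a b t
                       ≈ C R N a b t ⊕ (a ^ N ⊗ t) ⊗ sumRange R 1 N
                           (λ k → b ^ k ⊗ C R k a b t ⊗ C R (suc N ∸ k ∸ 1) a b ((a ⊗ b) ^ k ⊗ t))
    recurrence N = begin
      C R (suc N) a b t
        ≈⟨ C≈diag (suc N) ⟩
      diag (suc N)
        ≈⟨ diag-suc N ⟩
      down 0 (suc N) (suc N)
        ≈⟨ down₀-next-column N (suc N) ℕₚ.≤-refl ⟩
      sumBelow (suc N) (up 0 N) ⊕ (a ^ N ⊗ t) ⊗ sumBelow (suc N) (λ j → b ^ j ⊗ down 0 N j)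
        ≈⟨ +-cong lastColumn (*-congˡ (returns N)) ⟩
      diag N ⊕ (a ^ N ⊗ t) ⊗ sumFrom 1 N (λ k → diagWeight k ⊗ (up k N N ⊕ down k N N))
        ≈⟨ +-cong (sym (C≈diag N)) (*-congˡ (sumFrom-cong N 1 (term-k N))) ⟩
      C R N a b t ⊕ (a ^ N ⊗ t) ⊗ sumFrom 1 N F
        ≈⟨ +-congˡ (*-congˡ (sym (sumRange≈sumFrom N 1 N F ≡.refl))) ⟩
      C R N a b t ⊕ (a ^ N ⊗ t) ⊗ sumRange R 1 N F
        ∎
      where
      F : ℕ → Carrier
      F k = b ^ k ⊗ C R k a b t ⊗ C R (suc N ∸ k ∸ 1) a b ((a ⊗ b) ^ k ⊗ t)
      lastColumn : sumBelow (suc N) (up 0 N) ≈ diag N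
      lastColumn = trans (+-congʳ (sym (down-as-sum 0 N N ℕₚ.≤-refl))) (+-comm _ _)

theorem3p2 : ∀ {c ℓ : Level} (R : CommutativeSemiring c ℓ) →
    let open CommutativeSemiring R in
    (a b t : Carrier) (n : ℕ) → 1 ≤ n →
    C R n a b t ≈
      C R (n ∸ 1) a b t
      + pow R a (n ∸ 1) * t
        * sumRange R 1 (n ∸ 1)
            (λ k → pow R b k * C R k a b t * C R (n ∸ k ∸ 1) a b (pow R (a * b) k * t))
theorem3p2 R a b t (suc N) (s≤s z≤n) = Walks.recurrence R a b t N
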